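{- For every $\ell\in\mathbb{N}$ and every positive integer $k$, $$\det \left( f(\ell i, x, s)^j f(\ell i - 1, x, qs)^{k-j} \right)_{i,j=0}^k = \det \left( f(\ell i - 1, x, qs)^j \big(-f(\ell i, x, s)\big)^{k-j} \right)_{i,j=0}^k$$ and both equal $$(-1)^{\binom{k+1}{3} \ell}\, s^{ -\binom{k+1}{2} + \binom{k+1}{3} \ell}\, q^{\binom{k+1}{3} \binom{\ell}{2} + \binom{k+1}{4} \ell^2} \prod_{j=0}^{k-1} \mathrm{fac}(k-j, x, q^{\ell j} s, \ell).$$
   Context: Let $q,x,s$ be indeterminates. The Carlitz $q$-Fibonacci polynomials $f(n,x,s)$, $n\in\mathbb{Z}$, are the elements of $\mathbb{Q}(q,x,s)$ determined by $f(0,x,s)=0$, $f(1,x,s)=1$ and $f(n, x, s) = x f(n-1, x, s) + q^{n-2}s f(n-2, x, s)$ for all $n\in\mathbb{Z}$ (used in both directions, so $f$ is defined for negative $n$). $f(m,x,q^a s)$ means $f(m,x,t)$ with $t=q^a s$. For $k\ge 0$, $\mathrm{fac}(k,x,s,m)=\prod_{i=1}^k f(im,x,s)$ (empty product $=1$). -}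

module Defs where

open import Level using (Level)
open import Algebra.Bundles using (CommutativeRing)
open import Data.Nat as ℕ using (ℕ; zero; suc)
open import Data.Integer as ℤ using (ℤ; +_; -[1+_])
open import Data.Fin as F using (Fin; punchIn; toℕ)
open import Data.Product using (_×_; _,_; proj₁; proj₂)

-- All notions are defined over an arbitrary commutative ring R, in which
-- the indeterminates q, x, s live (q and s are required to be units in the
-- statement, so integer powers of q and s make sense).
module Ops {c l : Level} (R : CommutativeRing c l) where
  open CommutativeRing R

  _^_ : Carrier → ℕ → Carrier
  a ^ zero = 1#
  a ^ suc n = a * (a ^ n)

  zpow : Carrier → Carrier → ℤ → Carrier
  zpow a ainv (+ n) = a ^ n
  zpow a ainv -[1+ n ] = ainv ^ suc n

  sumFin : (n : ℕ) → (Fin n → Carrier) → Carrier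
  sumFin zero g = 0#
  sumFin (suc n) g = g F.zero + sumFin n (λ j → g (F.suc j))

  -- product over i = 1 .. k
  prod1 : ℕ → (ℕ → Carrier) → Carrier
  prod1 zero g = 1#
  prod1 (suc k) g = prod1 k g * g (suc k)

  -- product over j = 0 .. k-1
  prod0 : ℕ → (ℕ → Carrier) → Carrier
  prod0 zero g = 1#
  prod0 (suc k) g = prod0 k g * g k

  det : (n : ℕ) → (Fin n → Fin n → Carrier) → Carrier
  det zero M = 1#
  det (suc n) M =
    sumFin (suc n) (λ j → ((- 1#) ^ toℕ j) * (M F.zero j
      * det n (λ a b → M (F.suc a) (punchIn j b))))

  -- Recurrence f(n) = x f(n-1) + q^(n-2) t f(n-2), f(0)=0, f(1)=1,
  -- run forwards for n ≥ 2 and backwards for n < 0: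
  --   f(n-2) = (f(n) - x f(n-1)) * q^(-(n-2)) * t^(-1).
  module Fib (q qinv x t tinv : Carrier) where
    -- fwd m = (f(m), f(m+1))
    fwd : ℕ → Carrier × Carrier
    fwd zero = 0# , 1#
    fwd (suc m) = proj₂ (fwd m) , (x * proj₂ (fwd m) + (q ^ m) * (t * proj₁ (fwd m)))

    -- bwd m = (f(-m), f(1-m))
    bwd : ℕ → Carrier × Carrier
    bwd zero = 0# , 1#
    bwd (suc m) =
      ((proj₂ (bwd m) - x * proj₁ (bwd m)) * ((q ^ suc m) * tinv)) , proj₁ (bwd m)

    fib : ℤ → Carrier
    fib (+ n) = proj₁ (fwd n)
    fib -[1+ n ] = proj₁ (bwd (suc n))

  f : (q qinv x t tinv : Carrier) → ℤ → Carrier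
  f q qinv x t tinv = Fib.fib q qinv x t tinv

  fac : (q qinv x t tinv : Carrier) → (k : ℕ) → (m : ℕ) → Carrier
  fac q qinv x t tinv k m = prod1 k (λ i → f q qinv x t tinv (+ (i ℕ.* m)))

-- Write V(a, b) = det(a_i^j b_i^(k-j)) (the homogeneous Vandermonde determinant), F_t(n) = f(n, x, t) and
-- G_t(n) = f(n - 1, x, q t). Then G_t(n + 1) = F_{qt}(n) and F_t(n + 1) = q t G_{qt}(n) + x F_{qt}(n). Since V is
-- invariant under a ↦ a + x b (by column operations), homogeneous of degree (k+1 choose 2) in a, and changes by
-- the sign (-1)^(k+1 choose 2) when a and b are exchanged, replacing n by n + 1 in every row multiplies V by
-- ±(q t)^(k+1 choose 2) and t by q. For the rows n = ℓ i, the row i = 0 is (t⁻¹^(k+1), 0, …, 0); expanding along it,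
-- taking F_t(ℓ i) out of the other rows and shifting them ℓ times expresses the determinant of size k + 2 for t
-- through the one of size k + 1 for q^ℓ t, and induction on k gives the product formula. The second determinant is
-- the first with a and b exchanged and a negated, which multiplies it by the square of a sign.

module Submission where

open import Defs
open import Level using (Level)
open import Algebra.Bundles using (CommutativeRing)
open import Data.Nat using (ℕ; _<_; _∸_)
open import Data.Nat.Combinatorics using (_C_)
open import Data.Integer using (ℤ; +_)
open import Data.Integer as ℤ using ()
open import Data.Fin using (toℕ)
open import Data.Product using (_×_)

open import Data.Nat as ℕ using (zero; suc; _≤_; s≤s; _≤?_; _<?_)
import Data.Nat.Properties as ℕₚ
open import Data.Nat.Combinatorics using (nC1≡n; nCk+nC[k+1]≡[n+1]C[k+1])
open import Data.Nat.Tactic.RingSolver using (solve-∀)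
open import Data.Integer using (_⊖_)
import Data.Integer.Properties as ℤₚ
open import Data.Fin using (Fin; punchIn; punchOut; opposite; fromℕ<; inject₁; fromℕ)
  renaming (zero to fzero; suc to fsuc)
import Data.Fin.Properties as Fin
import Data.Fin.Permutation as Perm
open import Data.Vec.Functional using (updateAt; removeAt)
open import Data.Vec.Functional.Properties using (updateAt-updates; updateAt-minimal)
open import Data.Product using (_,_; proj₁; proj₂)
open import Data.Sum using (_⊎_; inj₁; inj₂)
open import Data.Empty using (⊥-elim)
open import Function using (_∘_)
open import Relation.Nullary using (Dec; yes; no)
open import Relation.Binary.PropositionalEquality as ≡ using (_≡_; _≢_)
import Algebra.Properties.Ring
import Algebra.Properties.CommutativeSemiring.Exp
import Algebra.Properties.Semiring.Sum
import Algebra.Properties.CommutativeMonoid.Sum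
import Algebra.Solver.Ring.NaturalCoefficients.Default

binomial-suc : ∀ n k → suc n C suc k ≡ n C suc k ℕ.+ n C k
binomial-suc n k = ≡.trans (≡.sym (nCk+nC[k+1]≡[n+1]C[k+1] n k)) (ℕₚ.+-comm (n C k) (n C suc k))

binomial-suc-2 : ∀ n → suc n C 2 ≡ n C 2 ℕ.+ n
binomial-suc-2 n = ≡.trans (binomial-suc n 1) (≡.cong (n C 2 ℕ.+_) (nC1≡n n))

module PowersAndProducts {r₁ r₂ : Level} (R : CommutativeRing r₁ r₂) where
  open CommutativeRing R
  open Ops R using (_^_; zpow; prod0; prod1)
  open Algebra.Properties.CommutativeMonoid.Sum *-commutativeMonoid
    using () renaming (sum to product; sum-cong-≋ to product-cong; sum-init-last to product-init-last)
  open import Relation.Binary.Reasoning.Setoid setoid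
  private
    module Exp = Algebra.Properties.CommutativeSemiring.Exp commutativeSemiring
    module RP = Algebra.Properties.Ring ring

  ^≡Exp-^ : ∀ a n → a ^ n ≡ a Exp.^ n
  ^≡Exp-^ a zero = ≡.refl
  ^≡Exp-^ a (suc n) = ≡.cong (a *_) (^≡Exp-^ a n)

  ^-congˡ : ∀ n {a b} → a ≈ b → a ^ n ≈ b ^ n
  ^-congˡ n {a} {b} a≈b rewrite ^≡Exp-^ a n | ^≡Exp-^ b n = Exp.^-congˡ n a≈b

  ^-congʳ : ∀ a {m n} → m ≡ n → a ^ m ≈ a ^ n
  ^-congʳ a ≡.refl = refl

  ^-homo-* : ∀ a m n → a ^ (m ℕ.+ n) ≈ a ^ m * a ^ n
  ^-homo-* a m n rewrite ^≡Exp-^ a (m ℕ.+ n) | ^≡Exp-^ a m | ^≡Exp-^ a n = Exp.^-homo-* a m n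

  ^-distrib-* : ∀ a b n → (a * b) ^ n ≈ a ^ n * b ^ n
  ^-distrib-* a b n rewrite ^≡Exp-^ (a * b) n | ^≡Exp-^ a n | ^≡Exp-^ b n = Exp.^-distrib-* a b n

  ^-assocʳ : ∀ a m n → (a ^ m) ^ n ≈ a ^ (m ℕ.* n)
  ^-assocʳ a m n rewrite ^≡Exp-^ a m | ^≡Exp-^ (a Exp.^ m) n | ^≡Exp-^ a (m ℕ.* n) = Exp.^-assocʳ a m n

  1^n≈1 : ∀ n → 1# ^ n ≈ 1#
  1^n≈1 zero = refl
  1^n≈1 (suc n) = trans (*-identityˡ _) (1^n≈1 n)

  ^-inverse : ∀ {a b} n → a * b ≈ 1# → a ^ n * b ^ n ≈ 1#
  ^-inverse {a} {b} n ab≈1 = begin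
    a ^ n * b ^ n ≈⟨ ^-distrib-* a b n ⟨
    (a * b) ^ n   ≈⟨ ^-congˡ n ab≈1 ⟩
    1# ^ n        ≈⟨ 1^n≈1 n ⟩
    1#            ∎

  sign : ℕ → Carrier
  sign n = (- 1#) ^ n

  sign-involutive : ∀ n → sign n * sign n ≈ 1#
  sign-involutive n = ^-inverse n (trans (RP.-1*x≈-x (- 1#)) (RP.-‿involutive 1#))

  sign-∸ : ∀ {m n} → n ≤ m → sign (m ∸ n) ≈ sign m * sign n
  sign-∸ {m} {n} n≤m = begin
    sign (m ∸ n)                     ≈⟨ *-identityʳ _ ⟨
    sign (m ∸ n) * 1#                ≈⟨ *-congˡ (sign-involutive n) ⟨
    sign (m ∸ n) * (sign n * sign n) ≈⟨ *-assoc _ _ _ ⟨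
    sign (m ∸ n) * sign n * sign n   ≈⟨ *-congʳ (^-homo-* (- 1#) (m ∸ n) n) ⟨
    sign (m ∸ n ℕ.+ n) * sign n      ≈⟨ *-congʳ (^-congʳ (- 1#) (ℕₚ.m∸n+n≡m n≤m)) ⟩
    sign m * sign n                  ∎

  product-powers : ∀ n u → product (λ (j : Fin n) → u ^ toℕ j) ≈ u ^ (n C 2)
  product-powers zero u = refl
  product-powers (suc n) u = begin
    product {suc n} (λ j → u ^ toℕ j)                         ≈⟨ product-init-last {n} (λ j → u ^ toℕ j) ⟩
    product {n} (λ j → u ^ toℕ (inject₁ j)) * u ^ toℕ (fromℕ n)
      ≈⟨ *-cong (product-cong {n} (λ j → ^-congʳ u (Fin.toℕ-inject₁ j))) (^-congʳ u (Fin.toℕ-fromℕ n)) ⟩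
    product {n} (λ j → u ^ toℕ j) * u ^ n                     ≈⟨ *-congʳ (product-powers n u) ⟩
    u ^ (n C 2) * u ^ n                                       ≈⟨ ^-homo-* u (n C 2) n ⟨
    u ^ (n C 2 ℕ.+ n)                                         ≈⟨ ^-congʳ u (binomial-suc-2 n) ⟨
    u ^ (suc n C 2)                                           ∎

  product≈prod1 : ∀ n (g : ℕ → Carrier) → product (λ (i : Fin n) → g (suc (toℕ i))) ≈ prod1 n g
  product≈prod1 zero g = refl
  product≈prod1 (suc n) g = begin
    product {suc n} (λ i → g (suc (toℕ i)))          ≈⟨ product-init-last {n} (λ i → g (suc (toℕ i))) ⟩
    product {n} (λ i → g (suc (toℕ (inject₁ i)))) * g (suc (toℕ (fromℕ n)))
      ≈⟨ *-cong (product-cong {n} (λ i → reflexive (≡.cong (g ∘ suc) (Fin.toℕ-inject₁ i))))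
                (reflexive (≡.cong (g ∘ suc) (Fin.toℕ-fromℕ n))) ⟩
    product {n} (λ i → g (suc (toℕ i))) * g (suc n)  ≈⟨ *-congʳ (product≈prod1 n g) ⟩
    prod1 (suc n) g                                  ∎

  prod0-cong : ∀ n {g h : ℕ → Carrier} → (∀ i → g i ≈ h i) → prod0 n g ≈ prod0 n h
  prod0-cong zero g≈h = refl
  prod0-cong (suc n) g≈h = *-cong (prod0-cong n g≈h) (g≈h n)

  prod1-cong : ∀ n {g h : ℕ → Carrier} → (∀ i → g i ≈ h i) → prod1 n g ≈ prod1 n h
  prod1-cong zero g≈h = refl
  prod1-cong (suc n) g≈h = *-cong (prod1-cong n g≈h) (g≈h (suc n))

  prod0-suc : ∀ n (g : ℕ → Carrier) → prod0 (suc n) g ≈ g 0 * prod0 n (g ∘ suc)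
  prod0-suc zero g = trans (*-identityˡ _) (sym (*-identityʳ _))
  prod0-suc (suc n) g = trans (*-congʳ (prod0-suc n g)) (*-assoc _ _ _)

  zpow-⊖ : ∀ {s s⁻¹} → s * s⁻¹ ≈ 1# → ∀ m n → zpow s s⁻¹ (n ⊖ m) ≈ s⁻¹ ^ m * s ^ n
  zpow-⊖ s*s⁻¹≈1 zero n = sym (*-identityˡ _)
  zpow-⊖ s*s⁻¹≈1 (suc m) zero = sym (*-identityʳ _)
  zpow-⊖ {s} {s⁻¹} s*s⁻¹≈1 (suc m) (suc n) = begin
    zpow s s⁻¹ (suc n ⊖ suc m)        ≡⟨ ≡.cong (zpow s s⁻¹) (ℤₚ.[1+m]⊖[1+n]≡m⊖n n m) ⟩
    zpow s s⁻¹ (n ⊖ m)                ≈⟨ zpow-⊖ s*s⁻¹≈1 m n ⟩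
    s⁻¹ ^ m * s ^ n                   ≈⟨ *-identityˡ _ ⟨
    1# * (s⁻¹ ^ m * s ^ n)            ≈⟨ *-congʳ (trans (*-comm s⁻¹ s) s*s⁻¹≈1) ⟨
    (s⁻¹ * s) * (s⁻¹ ^ m * s ^ n)     ≈⟨ *-assoc _ _ _ ⟩
    s⁻¹ * (s * (s⁻¹ ^ m * s ^ n))     ≈⟨ *-congˡ (trans (sym (*-assoc _ _ _)) (trans (*-congʳ (*-comm _ _)) (*-assoc _ _ _))) ⟩
    s⁻¹ * (s⁻¹ ^ m * (s * s ^ n))     ≈⟨ *-assoc _ _ _ ⟨
    s⁻¹ ^ suc m * s ^ suc n           ∎

  zpow-neg-+ : ∀ {s s⁻¹} → s * s⁻¹ ≈ 1# → ∀ m n → zpow s s⁻¹ (ℤ.- (+ m) ℤ.+ + n) ≈ s⁻¹ ^ m * s ^ n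
  zpow-neg-+ {s} {s⁻¹} s*s⁻¹≈1 m n =
    trans (reflexive (≡.cong (zpow s s⁻¹) (ℤₚ.-m+n≡n⊖m m n))) (zpow-⊖ s*s⁻¹≈1 m n)

punchIn-adjacent : ∀ {n} (i : Fin (suc n)) (a b : Fin n) →
  toℕ (punchIn i b) ≡ suc (toℕ (punchIn i a)) → toℕ b ≡ suc (toℕ a)
punchIn-adjacent fzero a b eq = ℕₚ.suc-injective eq
punchIn-adjacent (fsuc i) fzero fzero ()
punchIn-adjacent (fsuc i) fzero (fsuc fzero) eq = ≡.refl
punchIn-adjacent (fsuc fzero) fzero (fsuc (fsuc b)) ()
punchIn-adjacent (fsuc (fsuc i)) fzero (fsuc (fsuc b)) ()
punchIn-adjacent (fsuc i) (fsuc a) fzero ()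
punchIn-adjacent (fsuc i) (fsuc a) (fsuc b) eq =
  ≡.cong suc (punchIn-adjacent i a b (ℕₚ.suc-injective eq))

punchOut-adjacent : ∀ {n} {i c d : Fin (suc n)} (i≢c : i ≢ c) (i≢d : i ≢ d) →
  toℕ d ≡ suc (toℕ c) → toℕ (punchOut i≢d) ≡ suc (toℕ (punchOut i≢c))
punchOut-adjacent {i = i} i≢c i≢d d≡c+1 = punchIn-adjacent i _ _
  (≡.subst₂ (λ c d → toℕ d ≡ suc (toℕ c))
    (≡.sym (Fin.punchIn-punchOut i≢c)) (≡.sym (Fin.punchIn-punchOut i≢d)) d≡c+1)

punchIn-adjacent-holes : ∀ {n} (c d : Fin (suc n)) (b : Fin n) → toℕ d ≡ suc (toℕ c) →
  punchIn c b ≡ punchIn d b ⊎ (punchIn c b ≡ d × punchIn d b ≡ c)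
punchIn-adjacent-holes fzero fzero b ()
punchIn-adjacent-holes fzero (fsuc fzero) fzero _ = inj₂ (≡.refl , ≡.refl)
punchIn-adjacent-holes fzero (fsuc fzero) (fsuc b) _ = inj₁ ≡.refl
punchIn-adjacent-holes fzero (fsuc (fsuc d)) b ()
punchIn-adjacent-holes (fsuc c) fzero b ()
punchIn-adjacent-holes (fsuc c) (fsuc d) fzero _ = inj₁ ≡.refl
punchIn-adjacent-holes (fsuc c) (fsuc d) (fsuc b) eq
  with punchIn-adjacent-holes c d b (ℕₚ.suc-injective eq)
... | inj₁ same = inj₁ (≡.cong fsuc same)
... | inj₂ (c′ , d′) = inj₂ (≡.cong fsuc c′ , ≡.cong fsuc d′)

toℕ-punchIn-≤ : ∀ {n} (i : Fin (suc n)) (j : Fin n) → toℕ i ≤ toℕ j → toℕ (punchIn i j) ≡ suc (toℕ j)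
toℕ-punchIn-≤ fzero j _ = ≡.refl
toℕ-punchIn-≤ (fsuc i) (fsuc j) (s≤s i≤j) = ≡.cong suc (toℕ-punchIn-≤ i j i≤j)

toℕ-punchIn-> : ∀ {n} (i : Fin (suc n)) (j : Fin n) → toℕ j < toℕ i → toℕ (punchIn i j) ≡ toℕ j
toℕ-punchIn-> (fsuc i) fzero _ = ≡.refl
toℕ-punchIn-> (fsuc i) (fsuc j) (s≤s j<i) = ≡.cong suc (toℕ-punchIn-> i j j<i)

opposite-punchIn : ∀ {n} (i : Fin (suc n)) (j : Fin n) →
  opposite (punchIn i j) ≡ punchIn (opposite i) (opposite j)
opposite-punchIn {n} i j = Fin.toℕ-injective (by-cases (toℕ i ≤? toℕ j))
  where
  I = toℕ i
  J = toℕ j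
  J<n : J < n
  J<n = Fin.toℕ<n j
  toℕ-opposite-j : toℕ (opposite j) ≡ n ∸ suc J
  toℕ-opposite-j = Fin.opposite-prop j
  by-cases : Dec (I ≤ J) → toℕ (opposite (punchIn i j)) ≡ toℕ (punchIn (opposite i) (opposite j))
  by-cases (yes I≤J) = begin
    toℕ (opposite (punchIn i j))            ≡⟨ Fin.opposite-prop (punchIn i j) ⟩
    n ∸ toℕ (punchIn i j)                   ≡⟨ ≡.cong (n ∸_) (toℕ-punchIn-≤ i j I≤J) ⟩
    n ∸ suc J                               ≡⟨ toℕ-opposite-j ⟨
    toℕ (opposite j)                        ≡⟨ toℕ-punchIn-> (opposite i) (opposite j) opposite-j<opposite-i ⟨
    toℕ (punchIn (opposite i) (opposite j)) ∎
    where
    open ≡.≡-Reasoning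
    opposite-j<opposite-i : toℕ (opposite j) < toℕ (opposite i)
    opposite-j<opposite-i rewrite toℕ-opposite-j | Fin.opposite-prop i =
      ℕₚ.<-≤-trans (ℕₚ.∸-monoʳ-< (ℕₚ.n<1+n J) J<n) (ℕₚ.∸-monoʳ-≤ n I≤J)
  by-cases (no I≰J) = begin
    toℕ (opposite (punchIn i j))            ≡⟨ Fin.opposite-prop (punchIn i j) ⟩
    n ∸ toℕ (punchIn i j)                   ≡⟨ ≡.cong (n ∸_) (toℕ-punchIn-> i j (ℕₚ.≰⇒> I≰J)) ⟩
    n ∸ J                                   ≡⟨ ℕₚ.+-∸-assoc 1 J<n ⟩
    suc (n ∸ suc J)                         ≡⟨ ≡.cong suc toℕ-opposite-j ⟨
    suc (toℕ (opposite j))                  ≡⟨ toℕ-punchIn-≤ (opposite i) (opposite j) opposite-i≤opposite-j ⟨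
    toℕ (punchIn (opposite i) (opposite j)) ∎
    where
    open ≡.≡-Reasoning
    opposite-i≤opposite-j : toℕ (opposite i) ≤ toℕ (opposite j)
    opposite-i≤opposite-j rewrite toℕ-opposite-j | Fin.opposite-prop i = ℕₚ.∸-monoʳ-≤ n (ℕₚ.≰⇒> I≰J)

module Determinant {r₁ r₂ : Level} (R : CommutativeRing r₁ r₂) where
  open CommutativeRing R
  open Ops R using (_^_; sumFin; det)
  open PowersAndProducts R
  open import Relation.Binary.Reasoning.Setoid setoid
  open Algebra.Properties.Semiring.Sum semiring
    using (sum; sum-cong-≋; sum-replicate-zero; sum-remove; sum-permute; ∑-distrib-+; *-distribˡ-sum)
  open Algebra.Properties.CommutativeMonoid.Sum *-commutativeMonoid
    using () renaming (sum to product; sum-remove to product-remove)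
  open Algebra.Solver.Ring.NaturalCoefficients.Default commutativeSemiring
    using (solve; _:=_; _:+_; _:*_)

  Matrix : ℕ → Set r₁
  Matrix n = Fin n → Fin n → Carrier

  minor : ∀ {n} → Fin (suc n) → Matrix (suc n) → Matrix n
  minor j M a b = M (fsuc a) (punchIn j b)

  laplaceTerm : ∀ {n} → Matrix (suc n) → Fin (suc n) → Carrier
  laplaceTerm {n} M j = sign (toℕ j) * (M fzero j * det n (minor j M))

  sumFin≡sum : ∀ n (g : Fin n → Carrier) → sumFin n g ≡ sum g
  sumFin≡sum zero g = ≡.refl
  sumFin≡sum (suc n) g = ≡.cong (_+_ (g fzero)) (sumFin≡sum n (g ∘ fsuc))

  det-laplace : ∀ n (M : Matrix (suc n)) → det (suc n) M ≡ sum (laplaceTerm M)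
  det-laplace n M = sumFin≡sum (suc n) (laplaceTerm M)

  sum-pair : ∀ {n} (g : Fin (suc n) → Carrier) {c d} → c ≢ d →
    (∀ j → j ≢ c → j ≢ d → g j ≈ 0#) → sum g ≈ g c + g d
  sum-pair {zero} g {fzero} {fzero} c≢d _ = ⊥-elim (c≢d ≡.refl)
  sum-pair {suc n} g {c} {d} c≢d g≈0 = begin
    sum g                                       ≈⟨ sum-remove {i = c} g ⟩
    g c + sum (removeAt g c)                    ≈⟨ +-congˡ (sum-remove {i = punchOut c≢d} (removeAt g c)) ⟩
    g c + (g (punchIn c (punchOut c≢d)) + sum rest) ≡⟨ ≡.cong (λ e → g c + (g e + sum rest)) (Fin.punchIn-punchOut c≢d) ⟩
    g c + (g d + sum rest)                      ≈⟨ +-congˡ (+-congˡ (trans (sum-cong-≋ rest≈0) (sum-replicate-zero n))) ⟩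
    g c + (g d + 0#)                            ≈⟨ +-congˡ (+-identityʳ (g d)) ⟩
    g c + g d                                   ∎
    where
    rest = removeAt (removeAt g c) (punchOut c≢d)
    rest≈0 : ∀ k → rest k ≈ 0#
    rest≈0 k = g≈0 _ (Fin.punchInᵢ≢i c _) λ eq → Fin.punchInᵢ≢i (punchOut c≢d) k
      (Fin.punchIn-injective c _ _ (≡.trans eq (≡.sym (Fin.punchIn-punchOut c≢d))))

  det-cong : ∀ n {M N : Matrix n} → (∀ i j → M i j ≈ N i j) → det n M ≈ det n N
  det-cong zero _ = refl
  det-cong (suc n) {M} {N} M≈N = begin
    det (suc n) M       ≡⟨ det-laplace n M ⟩
    sum (laplaceTerm M) ≈⟨ sum-cong-≋ (λ j → *-congˡ {sign (toℕ j)} (*-cong (M≈N fzero j)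
                             (det-cong n (λ a b → M≈N (fsuc a) (punchIn j b))))) ⟩
    sum (laplaceTerm N) ≡⟨ det-laplace n N ⟨
    det (suc n) N       ∎

  det-scaleLaplaceTerms : ∀ n (M N : Matrix (suc n)) u →
    (∀ j → laplaceTerm M j ≈ u * laplaceTerm N j) → det (suc n) M ≈ u * det (suc n) N
  det-scaleLaplaceTerms n M N u M≈uN = begin
    det (suc n) M                   ≡⟨ det-laplace n M ⟩
    sum (laplaceTerm M)             ≈⟨ sum-cong-≋ M≈uN ⟩
    sum (λ j → u * laplaceTerm N j) ≈⟨ *-distribˡ-sum u (laplaceTerm N) ⟨
    u * sum (laplaceTerm N)         ≡⟨ ≡.cong (u *_) (det-laplace n N) ⟨
    u * det (suc n) N               ∎

  det-scaleRows : ∀ n (r : Fin n → Carrier) (M : Matrix n) →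
    det n (λ i j → r i * M i j) ≈ product r * det n M
  det-scaleRows zero r M = sym (*-identityʳ 1#)
  det-scaleRows (suc n) r M = det-scaleLaplaceTerms n rM M (product r) term
    where
    rM : Matrix (suc n)
    rM i j = r i * M i j
    term : ∀ j → laplaceTerm rM j ≈ product r * laplaceTerm M j
    term j = begin
      sign (toℕ j) * ((r fzero * M fzero j) * det n (minor j rM))
        ≈⟨ *-congˡ (*-congˡ (det-scaleRows n (r ∘ fsuc) (minor j M))) ⟩
      sign (toℕ j) * ((r fzero * M fzero j) * (product (r ∘ fsuc) * det n (minor j M)))
        ≈⟨ solve 5 (λ s r₀ m p d → (s :* ((r₀ :* m) :* (p :* d))) := ((r₀ :* p) :* (s :* (m :* d)))) refl
             (sign (toℕ j)) (r fzero) (M fzero j) (product (r ∘ fsuc)) (det n (minor j M)) ⟩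
      product r * laplaceTerm M j ∎

  det-scaleCols : ∀ n (g : Fin n → Carrier) (M : Matrix n) →
    det n (λ i j → g j * M i j) ≈ product g * det n M
  det-scaleCols zero g M = sym (*-identityʳ 1#)
  det-scaleCols (suc n) g M = det-scaleLaplaceTerms n gM M (product g) term
    where
    gM : Matrix (suc n)
    gM i j = g j * M i j
    term : ∀ j → laplaceTerm gM j ≈ product g * laplaceTerm M j
    term j = begin
      sign (toℕ j) * ((g j * M fzero j) * det n (minor j gM))
        ≈⟨ *-congˡ (*-congˡ (det-scaleCols n (g ∘ punchIn j) (minor j M))) ⟩
      sign (toℕ j) * ((g j * M fzero j) * (product (g ∘ punchIn j) * det n (minor j M)))
        ≈⟨ solve 5 (λ s g₀ m p d → (s :* ((g₀ :* m) :* (p :* d))) := ((g₀ :* p) :* (s :* (m :* d)))) refl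
             (sign (toℕ j)) (g j) (M fzero j) (product (g ∘ punchIn j)) (det n (minor j M)) ⟩
      (g j * product (g ∘ punchIn j)) * laplaceTerm M j
        ≈⟨ *-congʳ (product-remove {i = j} g) ⟨
      product g * laplaceTerm M j ∎

  det-linearCol : ∀ n (A B M : Matrix n) (c : Fin n) u v →
    (∀ i j → j ≢ c → M i j ≈ A i j) → (∀ i j → j ≢ c → M i j ≈ B i j) →
    (∀ i → M i c ≈ u * A i c + v * B i c) → det n M ≈ u * det n A + v * det n B
  det-linearCol (suc n) A B M c u v M≈A M≈B M≈uA+vB = begin
    det (suc n) M                                        ≡⟨ det-laplace n M ⟩
    sum (laplaceTerm M)                                  ≈⟨ sum-cong-≋ term ⟩
    sum (λ j → u * laplaceTerm A j + v * laplaceTerm B j) ≈⟨ ∑-distrib-+ (λ j → u * laplaceTerm A j) (λ j → v * laplaceTerm B j) ⟩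
    sum (λ j → u * laplaceTerm A j) + sum (λ j → v * laplaceTerm B j)
      ≈⟨ +-cong (*-distribˡ-sum u (laplaceTerm A)) (*-distribˡ-sum v (laplaceTerm B)) ⟨
    u * sum (laplaceTerm A) + v * sum (laplaceTerm B)
      ≡⟨ ≡.cong₂ (λ a b → u * a + v * b) (det-laplace n A) (det-laplace n B) ⟨
    u * det (suc n) A + v * det (suc n) B                ∎
    where
    term : ∀ j → laplaceTerm M j ≈ u * laplaceTerm A j + v * laplaceTerm B j
    term j with j Fin.≟ c
    ... | yes ≡.refl = begin
      sign (toℕ j) * (M fzero j * det n (minor j M))
        ≈⟨ *-congˡ (*-cong (M≈uA+vB fzero) minorM≈minorA) ⟩
      sign (toℕ j) * ((u * A fzero j + v * B fzero j) * det n (minor j A))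
        ≈⟨ solve 6 (λ s u v a b d → (s :* ((u :* a :+ v :* b) :* d)) := (u :* (s :* (a :* d)) :+ v :* (s :* (b :* d)))) refl
             (sign (toℕ j)) u v (A fzero j) (B fzero j) (det n (minor j A)) ⟩
      u * laplaceTerm A j + v * (sign (toℕ j) * (B fzero j * det n (minor j A)))
        ≈⟨ +-congˡ (*-congˡ (*-congˡ (*-congˡ (trans (sym minorM≈minorA) minorM≈minorB)))) ⟩
      u * laplaceTerm A j + v * laplaceTerm B j ∎
      where
      minorM≈minorA : det n (minor j M) ≈ det n (minor j A)
      minorM≈minorA = det-cong n (λ a b → M≈A (fsuc a) (punchIn j b) (Fin.punchInᵢ≢i j b))
      minorM≈minorB : det n (minor j M) ≈ det n (minor j B)
      minorM≈minorB = det-cong n (λ a b → M≈B (fsuc a) (punchIn j b) (Fin.punchInᵢ≢i j b))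
    ... | no j≢c = begin
      sign (toℕ j) * (M fzero j * det n (minor j M))
        ≈⟨ *-congˡ (*-congˡ minorM≈) ⟩
      sign (toℕ j) * (M fzero j * (u * det n (minor j A) + v * det n (minor j B)))
        ≈⟨ solve 6 (λ s m u v a b → (s :* (m :* (u :* a :+ v :* b))) := (u :* (s :* (m :* a)) :+ v :* (s :* (m :* b)))) refl
             (sign (toℕ j)) (M fzero j) u v (det n (minor j A)) (det n (minor j B)) ⟩
      u * (sign (toℕ j) * (M fzero j * det n (minor j A))) + v * (sign (toℕ j) * (M fzero j * det n (minor j B)))
        ≈⟨ +-cong (*-congˡ (*-congˡ (*-congʳ (M≈A fzero j j≢c)))) (*-congˡ (*-congˡ (*-congʳ (M≈B fzero j j≢c)))) ⟩
      u * laplaceTerm A j + v * laplaceTerm B j ∎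
      where
      c′ = punchOut j≢c
      off : ∀ b → b ≢ c′ → punchIn j b ≢ c
      off b b≢c′ eq = b≢c′ (Fin.punchIn-injective j b c′ (≡.trans eq (≡.sym (Fin.punchIn-punchOut j≢c))))
      minorM≈ : det n (minor j M) ≈ u * det n (minor j A) + v * det n (minor j B)
      minorM≈ = det-linearCol n (minor j A) (minor j B) (minor j M) c′ u v
        (λ a b b≢c′ → M≈A (fsuc a) (punchIn j b) (off b b≢c′))
        (λ a b b≢c′ → M≈B (fsuc a) (punchIn j b) (off b b≢c′))
        (λ a → ≡.subst (λ e → M (fsuc a) e ≈ u * A (fsuc a) e + v * B (fsuc a) e)
                 (≡.sym (Fin.punchIn-punchOut j≢c)) (M≈uA+vB (fsuc a)))

  det-adjacentCols : ∀ n (M : Matrix n) (c d : Fin n) → toℕ d ≡ suc (toℕ c) →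
    (∀ i → M i c ≈ M i d) → det n M ≈ 0#
  det-adjacentCols (suc zero) M fzero fzero ()
  det-adjacentCols (suc (suc n)) M c d d≡c+1 Mc≈Md = begin
    det (suc (suc n)) M                 ≡⟨ det-laplace (suc n) M ⟩
    sum (laplaceTerm M)                 ≈⟨ sum-pair (laplaceTerm M) c≢d (λ j j≢c j≢d → term≈0 j
                                             (det-adjacentCols (suc n) (minor j M) (punchOut j≢c) (punchOut j≢d)
                                               (punchOut-adjacent j≢c j≢d d≡c+1) (minor-adjacentCols j≢c j≢d))) ⟩
    laplaceTerm M c + laplaceTerm M d   ≈⟨ +-congˡ term-d≈-term-c ⟩
    laplaceTerm M c - laplaceTerm M c   ≈⟨ -‿inverseʳ _ ⟩
    0#                                  ∎
    where
    c≢d : c ≢ d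
    c≢d c≡d = ℕₚ.1+n≢n (≡.trans (≡.sym d≡c+1) (≡.cong toℕ (≡.sym c≡d)))
    minor-adjacentCols : ∀ {j} (j≢c : j ≢ c) (j≢d : j ≢ d) a →
      minor j M a (punchOut j≢c) ≈ minor j M a (punchOut j≢d)
    minor-adjacentCols j≢c j≢d a = ≡.subst₂ (λ e e′ → M (fsuc a) e ≈ M (fsuc a) e′)
      (≡.sym (Fin.punchIn-punchOut j≢c)) (≡.sym (Fin.punchIn-punchOut j≢d)) (Mc≈Md (fsuc a))
    term≈0 : ∀ j → det (suc n) (minor j M) ≈ 0# → laplaceTerm M j ≈ 0#
    term≈0 j minor≈0 = trans (*-congˡ (trans (*-congˡ minor≈0) (zeroʳ _))) (zeroʳ _)
    minors≈ : ∀ a b → minor d M a b ≈ minor c M a b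
    minors≈ a b with punchIn-adjacent-holes c d b d≡c+1
    ... | inj₁ same = reflexive (≡.cong (M (fsuc a)) (≡.sym same))
    ... | inj₂ (c↦d , d↦c) =
      ≡.subst₂ (λ e e′ → M (fsuc a) e ≈ M (fsuc a) e′) (≡.sym d↦c) (≡.sym c↦d) (Mc≈Md (fsuc a))
    term-d≈-term-c : laplaceTerm M d ≈ - laplaceTerm M c
    term-d≈-term-c = begin
      sign (toℕ d) * (M fzero d * det (suc n) (minor d M))
        ≈⟨ *-cong (^-congʳ (- 1#) d≡c+1) (*-cong (sym (Mc≈Md fzero)) (det-cong (suc n) minors≈)) ⟩
      (- 1# * sign (toℕ c)) * (M fzero c * det (suc n) (minor c M))
        ≈⟨ trans (*-assoc _ _ _) (RP.-1*x≈-x _) ⟩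
      - laplaceTerm M c ∎
      where module RP = Algebra.Properties.Ring ring

  det-addCol : ∀ n (M M′ : Matrix n) (c d : Fin n) t → toℕ d ≡ suc (toℕ c) →
    (∀ i j → j ≢ d → M′ i j ≈ M i j) → (∀ i → M′ i d ≈ M i d + t * M i c) → det n M′ ≈ det n M
  det-addCol n M M′ c d t d≡c+1 M′≈M M′d≈Md+tMc = begin
    det n M′                   ≈⟨ det-linearCol n M B M′ d 1# t M′≈M M′≈B M′d≈ ⟩
    1# * det n M + t * det n B ≈⟨ +-cong (*-identityˡ _) (trans (*-congˡ det-B≈0) (zeroʳ t)) ⟩
    det n M + 0#               ≈⟨ +-identityʳ _ ⟩
    det n M                    ∎
    where
    B : Matrix n
    B i = updateAt (M i) d (λ _ → M i c)
    c≢d : c ≢ d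
    c≢d c≡d = ℕₚ.1+n≢n (≡.trans (≡.sym d≡c+1) (≡.cong toℕ (≡.sym c≡d)))
    M′≈B : ∀ i j → j ≢ d → M′ i j ≈ B i j
    M′≈B i j j≢d = trans (M′≈M i j j≢d) (reflexive (≡.sym (updateAt-minimal j d (M i) j≢d)))
    M′d≈ : ∀ i → M′ i d ≈ 1# * M i d + t * B i d
    M′d≈ i = trans (M′d≈Md+tMc i)
      (+-cong (sym (*-identityˡ _)) (*-congˡ (reflexive (≡.sym (updateAt-updates d (M i))))))
    det-B≈0 : det n B ≈ 0#
    det-B≈0 = det-adjacentCols n B c d d≡c+1 λ i →
      reflexive (≡.trans (updateAt-minimal c d (M i) c≢d) (≡.sym (updateAt-updates d (M i))))

  -- Column indices as natural numbers, so that the column m ∸ 1 to the left of m can be named.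
  matrix : ∀ {n} → (Fin n → ℕ → Carrier) → Matrix n
  matrix E i j = E i (toℕ j)

  det-addPrevCol : ∀ n (E E′ : Fin n → ℕ → Carrier) D t →
    (∀ i m → m ≢ suc D → E′ i m ≈ E i m) →
    (suc D < n → ∀ i → E′ i (suc D) ≈ E i (suc D) + t * E i D) →
    det n (matrix E′) ≈ det n (matrix E)
  det-addPrevCol n E E′ D t E′≈E E′≈E+tE with suc D <? n
  ... | no D+1≮n = det-cong n λ i j → E′≈E i (toℕ j) λ j≡D+1 →
    D+1≮n (≡.subst (_< n) j≡D+1 (Fin.toℕ<n j))
  ... | yes D+1<n = det-addCol n (matrix E) (matrix E′) c d t d≡c+1 off at-d
    where
    d c : Fin n
    d = fromℕ< D+1<n
    c = fromℕ< (ℕₚ.<-trans (ℕₚ.n<1+n D) D+1<n)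
    toℕ-d : toℕ d ≡ suc D
    toℕ-d = Fin.toℕ-fromℕ< D+1<n
    toℕ-c : toℕ c ≡ D
    toℕ-c = Fin.toℕ-fromℕ< (ℕₚ.<-trans (ℕₚ.n<1+n D) D+1<n)
    d≡c+1 : toℕ d ≡ suc (toℕ c)
    d≡c+1 = ≡.trans toℕ-d (≡.cong suc (≡.sym toℕ-c))
    off : ∀ i j → j ≢ d → E′ i (toℕ j) ≈ E i (toℕ j)
    off i j j≢d = E′≈E i (toℕ j) λ j≡D+1 → j≢d (Fin.toℕ-injective (≡.trans j≡D+1 (≡.sym toℕ-d)))
    at-d : ∀ i → E′ i (toℕ d) ≈ E i (toℕ d) + t * E i (toℕ c)
    at-d i rewrite toℕ-d | toℕ-c = E′≈E+tE D+1<n i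

  -- The column operations are performed from the right, so that each adds a column not yet modified;
  -- partial p has performed those on the columns m ≥ p.
  det-addPrevCols : ∀ n (E E′ : Fin n → ℕ → Carrier) t r →
    (∀ i m → m < n → r < m → E′ i m ≈ E i m + t * E i (m ∸ 1)) →
    (∀ i m → m ≤ r → E′ i m ≈ E i m) →
    det n (matrix E′) ≈ det n (matrix E)
  det-addPrevCols n E E′ t r E′≈E+tE E′≈E = begin
    det n (matrix E′)                ≈⟨ det-cong n (λ i j → E′≈partial i (toℕ j)) ⟩
    det n (matrix (partial (suc r))) ≈⟨ partials n ⟩
    det n (matrix (partial (suc r ℕ.+ n))) ≈⟨ det-cong n (λ i j → reflexive (partial-beyond i j)) ⟩
    det n (matrix E)                 ∎
    where
    partial : ℕ → Fin n → ℕ → Carrier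
    partial p i m with p ≤? m
    ... | yes _ = E′ i m
    ... | no _ = E i m
    E′≈partial : ∀ i m → E′ i m ≈ partial (suc r) i m
    E′≈partial i m with suc r ≤? m
    ... | yes _ = refl
    ... | no r≮m = E′≈E i m (ℕₚ.≮⇒≥ r≮m)
    partial-beyond : ∀ i j → partial (suc r ℕ.+ n) i (toℕ j) ≡ E i (toℕ j)
    partial-beyond i j with suc r ℕ.+ n ≤? toℕ j
    ... | yes beyond = ⊥-elim (ℕₚ.<⇒≱ (ℕₚ.<-≤-trans (Fin.toℕ<n j) (ℕₚ.m≤n+m n (suc r))) beyond)
    ... | no _ = ≡.refl
    step : ∀ p → r < p → det n (matrix (partial p)) ≈ det n (matrix (partial (suc p)))
    step (suc D) r<p = det-addPrevCol n (partial (suc (suc D))) (partial (suc D)) D t off at-D+1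
      where
      off : ∀ i m → m ≢ suc D → partial (suc D) i m ≈ partial (suc (suc D)) i m
      off i m m≢D+1 with suc D ≤? m | suc (suc D) ≤? m
      ... | yes _ | yes _ = refl
      ... | no _ | no _ = refl
      ... | no D+1≰m | yes D+2≤m = ⊥-elim (D+1≰m (ℕₚ.<⇒≤ D+2≤m))
      ... | yes D+1≤m | no D+2≰m = ⊥-elim (m≢D+1 (ℕₚ.≤-antisym (ℕₚ.≮⇒≥ D+2≰m) D+1≤m))
      at-D+1 : suc D < n → ∀ i →
        partial (suc D) i (suc D) ≈ partial (suc (suc D)) i (suc D) + t * partial (suc (suc D)) i D
      at-D+1 D+1<n i with suc D ≤? suc D | suc (suc D) ≤? suc D | suc (suc D) ≤? D
      ... | yes _ | no _ | no _ = E′≈E+tE i (suc D) D+1<n r<p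
      ... | no D+1≰D+1 | _ | _ = ⊥-elim (D+1≰D+1 ℕₚ.≤-refl)
      ... | _ | yes D+2≤D+1 | _ = ⊥-elim (ℕₚ.n≮n (suc D) D+2≤D+1)
      ... | _ | _ | yes D+2≤D = ⊥-elim (ℕₚ.n≮n D (ℕₚ.<-trans (ℕₚ.n<1+n D) D+2≤D))
    partials : ∀ e → det n (matrix (partial (suc r))) ≈ det n (matrix (partial (suc r ℕ.+ e)))
    partials zero = reflexive (≡.cong (λ p → det n (matrix (partial p))) (≡.sym (ℕₚ.+-identityʳ (suc r))))
    partials (suc e) = begin
      det n (matrix (partial (suc r)))           ≈⟨ partials e ⟩
      det n (matrix (partial (suc r ℕ.+ e)))     ≈⟨ step (suc r ℕ.+ e) (s≤s (ℕₚ.m≤m+n r e)) ⟩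
      det n (matrix (partial (suc (suc r ℕ.+ e)))) ≡⟨ ≡.cong (λ p → det n (matrix (partial p))) (ℕₚ.+-suc (suc r) e) ⟨
      det n (matrix (partial (suc r ℕ.+ suc e))) ∎

  det-reverseCols : ∀ n (M : Matrix n) → det n (λ i j → M i (opposite j)) ≈ sign (n C 2) * det n M
  det-reverseCols zero M = sym (*-identityˡ 1#)
  det-reverseCols (suc n) M = begin
    det (suc n) Mᵒ                                 ≡⟨ det-laplace n Mᵒ ⟩
    sum (laplaceTerm Mᵒ)                           ≈⟨ sum-cong-≋ term ⟩
    sum (g ∘ opposite)                             ≈⟨ sum-permute g Perm.reverse ⟨
    sum g                                          ≈⟨ sum-cong-≋ g≈ ⟩
    sum (λ j → sign (suc n C 2) * laplaceTerm M j) ≈⟨ *-distribˡ-sum (sign (suc n C 2)) (laplaceTerm M) ⟨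
    sign (suc n C 2) * sum (laplaceTerm M)         ≡⟨ ≡.cong (sign (suc n C 2) *_) (det-laplace n M) ⟨
    sign (suc n C 2) * det (suc n) M               ∎
    where
    Mᵒ : Matrix (suc n)
    Mᵒ i j = M i (opposite j)
    g : Fin (suc n) → Carrier
    g j = sign (toℕ (opposite j)) * (M fzero j * (sign (n C 2) * det n (minor j M)))
    term : ∀ j → laplaceTerm Mᵒ j ≈ g (opposite j)
    term j = *-cong (^-congʳ (- 1#) (≡.cong toℕ (≡.sym (Fin.opposite-involutive j))))
      (*-congˡ (trans (det-cong n λ a b → reflexive (≡.cong (M (fsuc a)) (opposite-punchIn j b)))
                      (det-reverseCols n (minor (opposite j) M))))
    g≈ : ∀ j → g j ≈ sign (suc n C 2) * laplaceTerm M j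
    g≈ j = begin
      sign (toℕ (opposite j)) * (M fzero j * (sign (n C 2) * det n (minor j M)))
        ≈⟨ *-congʳ (trans (^-congʳ (- 1#) (Fin.opposite-prop j)) (sign-∸ (ℕ.s≤s⁻¹ (Fin.toℕ<n j)))) ⟩
      (sign n * sign (toℕ j)) * (M fzero j * (sign (n C 2) * det n (minor j M)))
        ≈⟨ solve 5 (λ s t m u d → ((s :* t) :* (m :* (u :* d))) := ((u :* s) :* (t :* (m :* d)))) refl
             (sign n) (sign (toℕ j)) (M fzero j) (sign (n C 2)) (det n (minor j M)) ⟩
      (sign (n C 2) * sign n) * laplaceTerm M j
        ≈⟨ *-congʳ (trans (^-congʳ (- 1#) (binomial-suc-2 n)) (^-homo-* (- 1#) (n C 2) n)) ⟨
      sign (suc n C 2) * laplaceTerm M j ∎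

  det-sparseFirstRow : ∀ n (M : Matrix (suc n)) → (∀ j → M fzero (fsuc j) ≈ 0#) →
    det (suc n) M ≈ M fzero fzero * det n (minor fzero M)
  det-sparseFirstRow n M row≈0 = begin
    det (suc n) M                                                 ≡⟨ det-laplace n M ⟩
    1# * (M fzero fzero * det n (minor fzero M)) + sum (laplaceTerm M ∘ fsuc)
      ≈⟨ +-cong (*-identityˡ _) (trans (sum-cong-≋ tail≈0) (sum-replicate-zero n)) ⟩
    M fzero fzero * det n (minor fzero M) + 0#                    ≈⟨ +-identityʳ _ ⟩
    M fzero fzero * det n (minor fzero M)                         ∎
    where
    tail≈0 : ∀ j → laplaceTerm M (fsuc j) ≈ 0#
    tail≈0 j = trans (*-congˡ (trans (*-congʳ (row≈0 j)) (zeroˡ _))) (zeroʳ _)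

module HomogeneousVandermonde {r₁ r₂ : Level} (R : CommutativeRing r₁ r₂) where
  open CommutativeRing R
  open Ops R using (_^_; det)
  open PowersAndProducts R
  open Determinant R
  open Algebra.Properties.CommutativeMonoid.Sum *-commutativeMonoid using () renaming (sum to product)
  open import Relation.Binary.Reasoning.Setoid setoid
  open Algebra.Solver.Ring.NaturalCoefficients.Default commutativeSemiring
    using (solve; _:=_; _:+_; _:*_)

  homVandermonde : ∀ k → (x y : Fin (suc k) → Carrier) → Carrier
  homVandermonde k x y = det (suc k) (λ i j → (x i ^ toℕ j) * (y i ^ (k ∸ toℕ j)))

  homVandermonde-cong : ∀ k {x x′ y y′ : Fin (suc k) → Carrier} →
    (∀ i → x i ≈ x′ i) → (∀ i → y i ≈ y′ i) → homVandermonde k x y ≈ homVandermonde k x′ y′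
  homVandermonde-cong k x≈x′ y≈y′ = det-cong (suc k) λ i j →
    *-cong (^-congˡ (toℕ j) (x≈x′ i)) (^-congˡ (k ∸ toℕ j) (y≈y′ i))

  homVandermonde-swap : ∀ k (x y : Fin (suc k) → Carrier) →
    homVandermonde k y x ≈ sign (suc k C 2) * homVandermonde k x y
  homVandermonde-swap k x y = begin
    homVandermonde k y x                            ≈⟨ det-cong (suc k) reversed ⟩
    det (suc k) (λ i j → M i (opposite j))          ≈⟨ det-reverseCols (suc k) M ⟩
    sign (suc k C 2) * homVandermonde k x y         ∎
    where
    M : Matrix (suc k)
    M i j = (x i ^ toℕ j) * (y i ^ (k ∸ toℕ j))
    reversed : ∀ i j → (y i ^ toℕ j) * (x i ^ (k ∸ toℕ j)) ≈ M i (opposite j)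
    reversed i j = trans (*-comm _ _) (*-cong
      (^-congʳ (x i) (≡.sym (Fin.opposite-prop j)))
      (^-congʳ (y i) (≡.sym (≡.trans (≡.cong (k ∸_) (Fin.opposite-prop j)) (ℕₚ.m∸[m∸n]≡n (ℕ.s≤s⁻¹ (Fin.toℕ<n j)))))))

  homVandermonde-scale : ∀ k u (x y : Fin (suc k) → Carrier) →
    homVandermonde k (λ i → u * x i) y ≈ u ^ (suc k C 2) * homVandermonde k x y
  homVandermonde-scale k u x y = begin
    homVandermonde k (λ i → u * x i) y
      ≈⟨ det-cong (suc k) (λ i j → trans (*-congʳ {y i ^ (k ∸ toℕ j)} (^-distrib-* u (x i) (toℕ j))) (*-assoc _ _ _)) ⟩
    det (suc k) (λ i j → (u ^ toℕ j) * ((x i ^ toℕ j) * (y i ^ (k ∸ toℕ j))))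
      ≈⟨ det-scaleCols (suc k) (λ j → u ^ toℕ j) (λ i j → (x i ^ toℕ j) * (y i ^ (k ∸ toℕ j))) ⟩
    product {suc k} (λ j → u ^ toℕ j) * homVandermonde k x y ≈⟨ *-congʳ (product-powers (suc k) u) ⟩
    u ^ (suc k C 2) * homVandermonde k x y                  ∎

  -- stage p has the columns z^m y^(k-m) for m < p and z^p x^(m-p) y^(k-m) for m ≥ p, where z = x + t y;
  -- passing from stage p to stage (p + 1) adds t times the previous column to each column m > p.
  homVandermonde-shear : ∀ k (x y : Fin (suc k) → Carrier) t →
    homVandermonde k (λ i → x i + t * y i) y ≈ homVandermonde k x y
  homVandermonde-shear k x y t = begin
    homVandermonde k z y                 ≈⟨ det-cong (suc k) (λ i j → reflexive (stage-final i j)) ⟨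
    det (suc k) (matrix (stage (suc k))) ≈⟨ stages (suc k) ⟩
    det (suc k) (matrix (stage 0))       ≈⟨ det-cong (suc k) (λ i j → *-congʳ {y i ^ (k ∸ toℕ j)} (*-identityˡ (x i ^ toℕ j))) ⟩
    homVandermonde k x y                 ∎
    where
    z : Fin (suc k) → Carrier
    z i = x i + t * y i
    stage : ℕ → Fin (suc k) → ℕ → Carrier
    stage p i m with p ≤? m
    ... | yes _ = (z i ^ p) * (x i ^ (m ∸ p)) * (y i ^ (k ∸ m))
    ... | no _ = (z i ^ m) * (y i ^ (k ∸ m))
    stage-final : ∀ i (j : Fin (suc k)) → stage (suc k) i (toℕ j) ≡ (z i ^ toℕ j) * (y i ^ (k ∸ toℕ j))
    stage-final i j with suc k ≤? toℕ j
    ... | yes k<j = ⊥-elim (ℕₚ.<⇒≱ (Fin.toℕ<n j) k<j)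
    ... | no _ = ≡.refl
    added : ∀ p i m → m < suc k → p < m → stage (suc p) i m ≈ stage p i m + t * stage p i (m ∸ 1)
    added p i (suc m) (s≤s m<k) (s≤s p≤m) with suc p ≤? suc m | p ≤? suc m | p ≤? m
    ... | no p≮m | _ | _ = ⊥-elim (p≮m (s≤s p≤m))
    ... | _ | no p≰m+1 | _ = ⊥-elim (p≰m+1 (ℕₚ.m≤n⇒m≤1+n p≤m))
    ... | _ | _ | no p≰m = ⊥-elim (p≰m p≤m)
    ... | yes _ | yes _ | yes _ = begin
      (z i * Z) * X * Y₊                 ≈⟨ solve 6 (λ x y t Z X Y₊ →
                                              (((x :+ t :* y) :* Z) :* X :* Y₊) := (Z :* (x :* X) :* Y₊ :+ t :* (Z :* X :* (y :* Y₊))))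
                                              refl (x i) (y i) t Z X Y₊ ⟩
      Z * (x i * X) * Y₊ + t * (Z * X * (y i * Y₊))
        ≈⟨ +-cong (*-congʳ (*-congˡ (^-congʳ (x i) (≡.sym (ℕₚ.+-∸-assoc 1 p≤m)))))
                  (*-congˡ (*-congˡ (^-congʳ (y i) (≡.sym (ℕₚ.+-∸-assoc 1 m<k))))) ⟩
      Z * (x i ^ (suc m ∸ p)) * Y₊ + t * (Z * X * (y i ^ (k ∸ m))) ∎
      where
      Z = z i ^ p
      X = x i ^ (m ∸ p)
      Y₊ = y i ^ (k ∸ suc m)
    unchanged : ∀ p i m → m ≤ p → stage (suc p) i m ≈ stage p i m
    unchanged p i m m≤p with suc p ≤? m | p ≤? m
    ... | yes p<m | _ = ⊥-elim (ℕₚ.<⇒≱ p<m m≤p)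
    ... | no _ | no _ = refl
    ... | no _ | yes p≤m with ℕₚ.≤-antisym m≤p p≤m
    ...   | ≡.refl = *-congʳ (sym (trans (*-congˡ (^-congʳ (x i) (ℕₚ.n∸n≡0 m))) (*-identityʳ _)))
    stages : ∀ p → det (suc k) (matrix (stage p)) ≈ det (suc k) (matrix (stage 0))
    stages zero = refl
    stages (suc p) = trans (det-addPrevCols (suc k) (stage p) (stage (suc p)) t p (added p) (unchanged p)) (stages p)

  homVandermonde-swap-neg : ∀ k (x y : Fin (suc k) → Carrier) →
    homVandermonde k y (λ i → - x i) ≈ homVandermonde k x y
  homVandermonde-swap-neg k x y = begin
    homVandermonde k y (λ i → - x i)                ≈⟨ homVandermonde-swap k (λ i → - x i) y ⟩
    sign T * homVandermonde k (λ i → - x i) y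
      ≈⟨ *-congˡ (homVandermonde-cong k {y = y} {y′ = y} (λ i → sym (RP.-1*x≈-x (x i))) (λ _ → refl)) ⟩
    sign T * homVandermonde k (λ i → - 1# * x i) y  ≈⟨ *-congˡ (homVandermonde-scale k (- 1#) x y) ⟩
    sign T * (sign T * homVandermonde k x y)        ≈⟨ *-assoc _ _ _ ⟨
    (sign T * sign T) * homVandermonde k x y        ≈⟨ *-congʳ (sign-involutive T) ⟩
    1# * homVandermonde k x y                       ≈⟨ *-identityˡ _ ⟩
    homVandermonde k x y                            ∎
    where
    T = suc k C 2
    module RP = Algebra.Properties.Ring ring

q-exponent-identity : ∀ T c₃ c₄ ℓ L →
  T ℕ.* L ℕ.+ (ℓ ℕ.* (c₃ ℕ.* ℓ) ℕ.+ (c₃ ℕ.* L ℕ.+ c₄ ℕ.* (ℓ ℕ.* ℓ))) ≡ (c₃ ℕ.+ T) ℕ.* L ℕ.+ (c₄ ℕ.+ c₃) ℕ.* (ℓ ℕ.* ℓ)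
q-exponent-identity = solve-∀

module LinearRecurrence {r₁ r₂ : Level} (R : CommutativeRing r₁ r₂) (x : CommutativeRing.Carrier R) where
  open CommutativeRing R
  open import Relation.Binary.Reasoning.Setoid setoid
  open Algebra.Solver.Ring.NaturalCoefficients.Default commutativeSemiring
    using (solve; _:=_; _:+_; _:*_)

  Satisfies : (ℕ → Carrier) → (ℕ → Carrier) → Set r₂
  Satisfies c u = ∀ n → u (suc (suc n)) ≈ x * u (suc n) + c n * u n

  satisfies-cong : ∀ {c c′ u} → (∀ n → c n ≈ c′ n) → Satisfies c u → Satisfies c′ u
  satisfies-cong c≈c′ rec n = trans (rec n) (+-congˡ (*-congʳ (c≈c′ n)))

  satisfies-+-* : ∀ {c u v} w → Satisfies c u → Satisfies c v → Satisfies c (λ n → u n + w * v n)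
  satisfies-+-* {c} {u} {v} w recᵤ recᵥ n = begin
    u (suc (suc n)) + w * v (suc (suc n))
      ≈⟨ +-cong (recᵤ n) (*-congˡ (recᵥ n)) ⟩
    (x * u (suc n) + c n * u n) + w * (x * v (suc n) + c n * v n)
      ≈⟨ solve 7 (λ x w c u₀ u₁ v₀ v₁ →
           ((x :* u₁ :+ c :* u₀) :+ w :* (x :* v₁ :+ c :* v₀)) := (x :* (u₁ :+ w :* v₁) :+ c :* (u₀ :+ w :* v₀)))
           refl x w (c n) (u n) (u (suc n)) (v n) (v (suc n)) ⟩
    x * (u (suc n) + w * v (suc n)) + c n * (u n + w * v n) ∎

  satisfies-unique : ∀ {c u v} → Satisfies c u → Satisfies c v → u 0 ≈ v 0 → u 1 ≈ v 1 → ∀ n → u n ≈ v n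
  satisfies-unique {c} {u} {v} recᵤ recᵥ u₀≈v₀ u₁≈v₁ n = proj₁ (consecutive n)
    where
    consecutive : ∀ n → u n ≈ v n × u (suc n) ≈ v (suc n)
    consecutive zero = u₀≈v₀ , u₁≈v₁
    consecutive (suc n) with consecutive n
    ... | uₙ≈vₙ , uₙ₊₁≈vₙ₊₁ = uₙ₊₁≈vₙ₊₁ ,
      trans (recᵤ n) (trans (+-cong (*-congˡ uₙ₊₁≈vₙ₊₁) (*-congˡ uₙ≈vₙ)) (sym (recᵥ n)))

module CarlitzFibonacci {r₁ r₂ : Level} (R : CommutativeRing r₁ r₂) (q q⁻¹ x : CommutativeRing.Carrier R) where
  open CommutativeRing R
  open Ops R using (_^_; f; fac; prod1; prod0; det; module Fib)
  open PowersAndProducts R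
  open LinearRecurrence R x
  open import Relation.Binary.Reasoning.Setoid setoid
  open Algebra.Solver.Ring.NaturalCoefficients.Default commutativeSemiring
    using (solve; _:=_; _:+_; _:*_)

  -- Fib.fwd without its unused inverse arguments, so that it can be shown to respect ≈ in t.
  carlitzPair : Carrier → ℕ → Carrier × Carrier
  carlitzPair t zero = 0# , 1#
  carlitzPair t (suc n) = proj₂ (carlitzPair t n) , x * proj₂ (carlitzPair t n) + (q ^ n) * (t * proj₁ (carlitzPair t n))

  carlitz : Carrier → ℕ → Carrier
  carlitz t n = proj₁ (carlitzPair t n)

  -- carlitzPred t t⁻¹ n = f(n - 1, x, q t), where f(-1, x, q t) = t⁻¹
  carlitzPred : Carrier → Carrier → ℕ → Carrier
  carlitzPred t t⁻¹ zero = t⁻¹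
  carlitzPred t t⁻¹ (suc n) = carlitz (q * t) n

  fwd≡carlitzPair : ∀ t t⁻¹ n → Fib.fwd q q⁻¹ x t t⁻¹ n ≡ carlitzPair t n
  fwd≡carlitzPair t t⁻¹ zero = ≡.refl
  fwd≡carlitzPair t t⁻¹ (suc n) =
    ≡.cong (λ p → proj₂ p , x * proj₂ p + (q ^ n) * (t * proj₁ p)) (fwd≡carlitzPair t t⁻¹ n)

  f≡carlitz : ∀ t t⁻¹ n → f q q⁻¹ x t t⁻¹ (ℤ.+ n) ≡ carlitz t n
  f≡carlitz t t⁻¹ n = ≡.cong proj₁ (fwd≡carlitzPair t t⁻¹ n)

  carlitz-satisfies : ∀ t → Satisfies (λ n → q ^ n * t) (carlitz t)
  carlitz-satisfies t n = +-congˡ (sym (*-assoc _ _ _))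

  carlitz-cong : ∀ {t t′} → t ≈ t′ → ∀ n → carlitz t n ≈ carlitz t′ n
  carlitz-cong {t} {t′} t≈t′ = satisfies-unique (carlitz-satisfies t)
    (satisfies-cong (λ n → *-congˡ (sym t≈t′)) (carlitz-satisfies t′)) refl refl

  carlitzPred-cong : ∀ {t t′ t⁻¹ t′⁻¹} → t ≈ t′ → t⁻¹ ≈ t′⁻¹ → ∀ n → carlitzPred t t⁻¹ n ≈ carlitzPred t′ t′⁻¹ n
  carlitzPred-cong t≈t′ t⁻¹≈t′⁻¹ zero = t⁻¹≈t′⁻¹
  carlitzPred-cong t≈t′ t⁻¹≈t′⁻¹ (suc n) = carlitz-cong (*-congˡ t≈t′) n

  module ShiftIdentity (q*q⁻¹≈1 : q * q⁻¹ ≈ 1#) (t t⁻¹ : Carrier) (t*t⁻¹≈1 : t * t⁻¹ ≈ 1#) where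
    qt*q⁻¹t⁻¹≈1 : (q * t) * (q⁻¹ * t⁻¹) ≈ 1#
    qt*q⁻¹t⁻¹≈1 = begin
      (q * t) * (q⁻¹ * t⁻¹) ≈⟨ solve 4 (λ q t q′ t′ → ((q :* t) :* (q′ :* t′)) := ((q :* q′) :* (t :* t′))) refl q t q⁻¹ t⁻¹ ⟩
      (q * q⁻¹) * (t * t⁻¹) ≈⟨ *-cong q*q⁻¹≈1 t*t⁻¹≈1 ⟩
      1# * 1#               ≈⟨ *-identityˡ 1# ⟩
      1#                    ∎

    c : ℕ → Carrier
    c n = q ^ suc n * t

    h : ℕ → Carrier
    h n = (q * t) * carlitzPred (q * t) (q⁻¹ * t⁻¹) n

    shifted-satisfies : Satisfies c (λ n → carlitz t (suc n))
    shifted-satisfies n = carlitz-satisfies t (suc n)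

    qt-satisfies : Satisfies c (carlitz (q * t))
    qt-satisfies = satisfies-cong (λ n → solve 3 (λ Q q t → (Q :* (q :* t)) := ((q :* Q) :* t)) refl (q ^ n) q t)
      (carlitz-satisfies (q * t))

    h-satisfies : Satisfies c h
    h-satisfies zero = begin
      (q * t) * 1#                           ≈⟨ *-identityʳ _ ⟩
      q * t                                  ≈⟨ +-identityˡ _ ⟨
      0# + q * t                             ≈⟨ +-cong (sym (trans (*-congˡ (zeroʳ _)) (zeroʳ x)))
                                                   (sym (trans (*-cong (*-congʳ (*-identityʳ q)) qt*q⁻¹t⁻¹≈1) (*-identityʳ _))) ⟩
      x * ((q * t) * 0#) + ((q * 1#) * t) * h 0 ∎
    h-satisfies (suc n) = solve 6 (λ q t x Q F₀ F₁ →
      ((q :* t) :* (x :* F₁ :+ Q :* ((q :* (q :* t)) :* F₀))) := (x :* ((q :* t) :* F₁) :+ ((q :* (q :* Q)) :* t) :* ((q :* t) :* F₀)))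
      refl q t x (q ^ n) (carlitz (q * (q * t)) n) (carlitz (q * (q * t)) (suc n))

    -- f(n + 1, x, t) = q t f(n - 1, x, q² t) + x f(n, x, q t): both sides solve the same recurrence.
    carlitz-shift : ∀ n → carlitz t (suc n) ≈ h n + x * carlitz (q * t) n
    carlitz-shift = satisfies-unique shifted-satisfies (satisfies-+-* x h-satisfies qt-satisfies) initial₀ initial₁
      where
      initial₀ : 1# ≈ h 0 + x * 0#
      initial₀ = sym (trans (+-cong qt*q⁻¹t⁻¹≈1 (zeroʳ x)) (+-identityʳ 1#))
      initial₁ : x * 1# + 1# * (t * 0#) ≈ (q * t) * 0# + x * 1#
      initial₁ = trans (+-congˡ (trans (*-identityˡ _) (zeroʳ t)))
        (trans (+-identityʳ _) (sym (trans (+-congʳ (zeroʳ _)) (+-identityˡ _))))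

  module Evaluation (q*q⁻¹≈1 : q * q⁻¹ ≈ 1#) where
    open Determinant R using (det-sparseFirstRow; det-scaleRows; det-cong)
    open HomogeneousVandermonde R
    open Algebra.Properties.CommutativeMonoid.Sum *-commutativeMonoid using () renaming (sum to product)

    homVandermonde-shift : ∀ k (ns : Fin (suc k) → ℕ) t t⁻¹ → t * t⁻¹ ≈ 1# →
      homVandermonde k (λ i → carlitz t (suc (ns i))) (λ i → carlitzPred t t⁻¹ (suc (ns i)))
        ≈ (sign (suc k C 2) * (q * t) ^ (suc k C 2)) *
          homVandermonde k (λ i → carlitz (q * t) (ns i)) (λ i → carlitzPred (q * t) (q⁻¹ * t⁻¹) (ns i))
    homVandermonde-shift k ns t t⁻¹ t*t⁻¹≈1 = begin
      homVandermonde k (λ i → carlitz t (suc (ns i))) F′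
        ≈⟨ homVandermonde-cong k {y = F′} {y′ = F′} (λ i → carlitz-shift (ns i)) (λ i → refl) ⟩
      homVandermonde k (λ i → (q * t) * G′ i + x * F′ i) F′ ≈⟨ homVandermonde-shear k (λ i → (q * t) * G′ i) F′ x ⟩
      homVandermonde k (λ i → (q * t) * G′ i) F′            ≈⟨ homVandermonde-scale k (q * t) G′ F′ ⟩
      (q * t) ^ T * homVandermonde k G′ F′                  ≈⟨ *-congˡ (homVandermonde-swap k F′ G′) ⟩
      (q * t) ^ T * (sign T * homVandermonde k F′ G′)       ≈⟨ solve 3 (λ u s v → (u :* (s :* v)) := ((s :* u) :* v)) refl _ _ _ ⟩
      (sign T * (q * t) ^ T) * homVandermonde k F′ G′       ∎
      where
      open ShiftIdentity q*q⁻¹≈1 t t⁻¹ t*t⁻¹≈1 using (carlitz-shift)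
      T = suc k C 2
      F′ G′ : Fin (suc k) → Carrier
      F′ i = carlitz (q * t) (ns i)
      G′ i = carlitzPred (q * t) (q⁻¹ * t⁻¹) (ns i)

    shiftFactor : ℕ → ℕ → Carrier → Carrier
    shiftFactor zero k t = 1#
    shiftFactor (suc L) k t = (sign (suc k C 2) * (q * t) ^ (suc k C 2)) * shiftFactor L k (q * t)

    homVandermonde-shifts : ∀ L k (ns : Fin (suc k) → ℕ) t t⁻¹ → t * t⁻¹ ≈ 1# →
      homVandermonde k (λ i → carlitz t (L ℕ.+ ns i)) (λ i → carlitzPred t t⁻¹ (L ℕ.+ ns i))
        ≈ shiftFactor L k t *
          homVandermonde k (λ i → carlitz (q ^ L * t) (ns i)) (λ i → carlitzPred (q ^ L * t) (q⁻¹ ^ L * t⁻¹) (ns i))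
    homVandermonde-shifts zero k ns t t⁻¹ _ = sym (trans (*-identityˡ _) (homVandermonde-cong k
      (λ i → carlitz-cong (*-identityˡ t) (ns i)) (λ i → carlitzPred-cong (*-identityˡ t) (*-identityˡ t⁻¹) (ns i))))
    homVandermonde-shifts (suc L) k ns t t⁻¹ t*t⁻¹≈1 = begin
      homVandermonde k (λ i → carlitz t (suc (L ℕ.+ ns i))) (λ i → carlitzPred t t⁻¹ (suc (L ℕ.+ ns i)))
        ≈⟨ homVandermonde-shift k (λ i → L ℕ.+ ns i) t t⁻¹ t*t⁻¹≈1 ⟩
      S * homVandermonde k (λ i → carlitz (q * t) (L ℕ.+ ns i)) (λ i → carlitzPred (q * t) (q⁻¹ * t⁻¹) (L ℕ.+ ns i))
        ≈⟨ *-congˡ (homVandermonde-shifts L k ns (q * t) (q⁻¹ * t⁻¹) (ShiftIdentity.qt*q⁻¹t⁻¹≈1 q*q⁻¹≈1 t t⁻¹ t*t⁻¹≈1)) ⟩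
      S * (shiftFactor L k (q * t) *
           homVandermonde k (λ i → carlitz (q ^ L * (q * t)) (ns i)) (λ i → carlitzPred (q ^ L * (q * t)) (q⁻¹ ^ L * (q⁻¹ * t⁻¹)) (ns i)))
        ≈⟨ *-assoc _ _ _ ⟨
      shiftFactor (suc L) k t *
           homVandermonde k (λ i → carlitz (q ^ L * (q * t)) (ns i)) (λ i → carlitzPred (q ^ L * (q * t)) (q⁻¹ ^ L * (q⁻¹ * t⁻¹)) (ns i))
        ≈⟨ *-congˡ (homVandermonde-cong k (λ i → carlitz-cong (regroup q t) (ns i))
                     (λ i → carlitzPred-cong (regroup q t) (regroup q⁻¹ t⁻¹) (ns i))) ⟩
      shiftFactor (suc L) k t *
           homVandermonde k (λ i → carlitz (q ^ suc L * t) (ns i)) (λ i → carlitzPred (q ^ suc L * t) (q⁻¹ ^ suc L * t⁻¹) (ns i)) ∎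
      where
      S = sign (suc k C 2) * (q * t) ^ (suc k C 2)
      regroup : ∀ u v → u ^ L * (u * v) ≈ u ^ suc L * v
      regroup u v = solve 3 (λ U u v → (U :* (u :* v)) := ((u :* U) :* v)) refl (u ^ L) u v

    shiftFactor-closed : ∀ L k t → let T = suc k C 2 in
      shiftFactor L k t ≈ sign (T ℕ.* L) * (q ^ (T ℕ.* (suc L C 2)) * t ^ (T ℕ.* L))
    shiftFactor-closed zero k t rewrite ℕₚ.*-zeroʳ (suc k C 2) = sym (trans (*-identityˡ _) (*-identityˡ 1#))
    shiftFactor-closed (suc L) k t = begin
      (sign T * (q * t) ^ T) * shiftFactor L k (q * t)
        ≈⟨ *-cong (*-congˡ (^-distrib-* q t T)) (shiftFactor-closed L k (q * t)) ⟩
      (sign T * (q ^ T * t ^ T)) * (sign (T ℕ.* L) * (q ^ (T ℕ.* (suc L C 2)) * (q * t) ^ (T ℕ.* L)))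
        ≈⟨ *-congˡ (*-congˡ (*-congˡ (^-distrib-* q t (T ℕ.* L)))) ⟩
      (sign T * (q ^ T * t ^ T)) * (sign (T ℕ.* L) * (q ^ (T ℕ.* (suc L C 2)) * (q ^ (T ℕ.* L) * t ^ (T ℕ.* L))))
        ≈⟨ solve 7 (λ s a b s′ c a′ b′ → ((s :* (a :* b)) :* (s′ :* (c :* (a′ :* b′)))) := ((s :* s′) :* ((c :* (a :* a′)) :* (b :* b′))))
             refl _ _ _ _ _ _ _ ⟩
      (sign T * sign (T ℕ.* L)) * (q ^ (T ℕ.* (suc L C 2)) * (q ^ T * q ^ (T ℕ.* L)) * (t ^ T * t ^ (T ℕ.* L)))
        ≈⟨ *-cong (^-homo-* (- 1#) T (T ℕ.* L)) (*-cong (*-congˡ (^-homo-* q T (T ℕ.* L))) (^-homo-* t T (T ℕ.* L))) ⟨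
      sign (T ℕ.+ T ℕ.* L) * (q ^ (T ℕ.* (suc L C 2)) * q ^ (T ℕ.+ T ℕ.* L) * t ^ (T ℕ.+ T ℕ.* L))
        ≈⟨ *-congˡ (*-congʳ (^-homo-* q (T ℕ.* (suc L C 2)) (T ℕ.+ T ℕ.* L))) ⟨
      sign (T ℕ.+ T ℕ.* L) * (q ^ (T ℕ.* (suc L C 2) ℕ.+ (T ℕ.+ T ℕ.* L)) * t ^ (T ℕ.+ T ℕ.* L))
        ≈⟨ *-cong (^-congʳ (- 1#) T+TL≡T[1+L]) (*-cong (^-congʳ q exponent) (^-congʳ t T+TL≡T[1+L])) ⟩
      sign (T ℕ.* suc L) * (q ^ (T ℕ.* (suc (suc L) C 2)) * t ^ (T ℕ.* suc L)) ∎
      where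
      T = suc k C 2
      T+TL≡T[1+L] : T ℕ.+ T ℕ.* L ≡ T ℕ.* suc L
      T+TL≡T[1+L] = ≡.sym (ℕₚ.*-suc T L)
      exponent : T ℕ.* (suc L C 2) ℕ.+ (T ℕ.+ T ℕ.* L) ≡ T ℕ.* (suc (suc L) C 2)
      exponent = ≡.trans (≡.cong (T ℕ.* (suc L C 2) ℕ.+_) T+TL≡T[1+L])
        (≡.trans (≡.sym (ℕₚ.*-distribˡ-+ T (suc L C 2) (suc L))) (≡.cong (T ℕ.*_) (≡.sym (binomial-suc-2 (suc L)))))

    module _ (ℓ : ℕ) where
      carlitzDet : Carrier → Carrier → ℕ → Carrier
      carlitzDet t t⁻¹ k = homVandermonde k (λ i → carlitz t (toℕ i ℕ.* ℓ)) (λ i → carlitzPred t t⁻¹ (toℕ i ℕ.* ℓ))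

      carlitzDet-suc : ∀ k t t⁻¹ → t * t⁻¹ ≈ 1# →
        carlitzDet t t⁻¹ (suc k) ≈ t⁻¹ ^ suc k *
          (prod1 (suc k) (λ i → carlitz t (i ℕ.* ℓ)) * (shiftFactor ℓ k t * carlitzDet (q ^ ℓ * t) (q⁻¹ ^ ℓ * t⁻¹) k))
      carlitzDet-suc k t t⁻¹ t*t⁻¹≈1 = begin
        carlitzDet t t⁻¹ (suc k)
          ≈⟨ det-sparseFirstRow (suc k) M (λ j → trans (*-congʳ (zeroˡ (0# ^ toℕ j))) (zeroˡ (t⁻¹ ^ (k ∸ toℕ j)))) ⟩
        (1# * t⁻¹ ^ suc k) * det (suc k) (λ a b → (F a * F a ^ toℕ b) * G a ^ (k ∸ toℕ b))
          ≈⟨ *-cong (*-identityˡ _) (det-cong (suc k) (λ a b → *-assoc (F a) (F a ^ toℕ b) (G a ^ (k ∸ toℕ b)))) ⟩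
        t⁻¹ ^ suc k * det (suc k) (λ a b → F a * (F a ^ toℕ b * G a ^ (k ∸ toℕ b)))
          ≈⟨ *-congˡ (det-scaleRows (suc k) F (λ a b → F a ^ toℕ b * G a ^ (k ∸ toℕ b))) ⟩
        t⁻¹ ^ suc k * (product F * homVandermonde k F G)
          ≈⟨ *-congˡ (*-cong (product≈prod1 (suc k) (λ i → carlitz t (i ℕ.* ℓ)))
                              (homVandermonde-shifts ℓ k (λ i → toℕ i ℕ.* ℓ) t t⁻¹ t*t⁻¹≈1)) ⟩
        t⁻¹ ^ suc k * (prod1 (suc k) (λ i → carlitz t (i ℕ.* ℓ)) * (shiftFactor ℓ k t * carlitzDet (q ^ ℓ * t) (q⁻¹ ^ ℓ * t⁻¹) k)) ∎
        where
        M : Fin (suc (suc k)) → Fin (suc (suc k)) → Carrier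
        M i j = (carlitz t (toℕ i ℕ.* ℓ) ^ toℕ j) * (carlitzPred t t⁻¹ (toℕ i ℕ.* ℓ) ^ (suc k ∸ toℕ j))
        F G : Fin (suc k) → Carrier
        F a = carlitz t (ℓ ℕ.+ toℕ a ℕ.* ℓ)
        G a = carlitzPred t t⁻¹ (ℓ ℕ.+ toℕ a ℕ.* ℓ)

      facProduct : Carrier → ℕ → Carrier
      facProduct t k = prod0 k (λ j → prod1 (k ∸ j) (λ i → carlitz (q ^ (ℓ ℕ.* j) * t) (i ℕ.* ℓ)))

      facProduct-suc : ∀ k t → facProduct t (suc k) ≈ prod1 (suc k) (λ i → carlitz t (i ℕ.* ℓ)) * facProduct (q ^ ℓ * t) k
      facProduct-suc k t = trans (prod0-suc k _) (*-cong
        (prod1-cong (suc k) (λ i → carlitz-cong (trans (*-congʳ (^-congʳ q (ℕₚ.*-zeroʳ ℓ))) (*-identityˡ t)) (i ℕ.* ℓ)))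
        (prod0-cong k (λ j → prod1-cong (k ∸ j) (λ i → carlitz-cong (regroup j) (i ℕ.* ℓ)))))
        where
        regroup : ∀ j → q ^ (ℓ ℕ.* suc j) * t ≈ q ^ (ℓ ℕ.* j) * (q ^ ℓ * t)
        regroup j = trans (*-congʳ (trans (^-congʳ q (ℕₚ.*-suc ℓ j)) (^-homo-* q ℓ (ℓ ℕ.* j))))
          (solve 3 (λ a b t → ((a :* b) :* t) := (b :* (a :* t))) refl (q ^ ℓ) (q ^ (ℓ ℕ.* j)) t)

      qExponent : ℕ → ℕ
      qExponent k = (suc k C 3) ℕ.* (ℓ C 2) ℕ.+ (suc k C 4) ℕ.* (ℓ ℕ.* ℓ)

      closedForm : Carrier → Carrier → ℕ → Carrier
      closedForm t t⁻¹ k =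
        sign ((suc k C 3) ℕ.* ℓ) * ((t⁻¹ ^ (suc k C 2) * t ^ ((suc k C 3) ℕ.* ℓ)) * (q ^ qExponent k * facProduct t k))

      qExponent-suc : ∀ k → let T = suc k C 2; c₃ = suc k C 3 in
        (q ^ (T ℕ.* (suc ℓ C 2)) * (q⁻¹ ^ ℓ) ^ T) * ((q ^ ℓ) ^ (c₃ ℕ.* ℓ) * q ^ qExponent k) ≈ q ^ qExponent (suc k)
      qExponent-suc k = begin
        (q ^ (T ℕ.* (suc ℓ C 2)) * (q⁻¹ ^ ℓ) ^ T) * ((q ^ ℓ) ^ (c₃ ℕ.* ℓ) * q ^ qExponent k)
          ≈⟨ *-cong (*-cong (trans (^-congʳ q split) (^-homo-* q (T ℕ.* (ℓ C 2)) (ℓ ℕ.* T))) (^-assocʳ q⁻¹ ℓ T))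
                    (*-congʳ (^-assocʳ q ℓ (c₃ ℕ.* ℓ))) ⟩
        (q ^ (T ℕ.* (ℓ C 2)) * q ^ (ℓ ℕ.* T) * q⁻¹ ^ (ℓ ℕ.* T)) * (q ^ (ℓ ℕ.* (c₃ ℕ.* ℓ)) * q ^ qExponent k)
          ≈⟨ *-congʳ (trans (*-assoc _ _ _) (trans (*-congˡ (^-inverse (ℓ ℕ.* T) q*q⁻¹≈1)) (*-identityʳ _))) ⟩
        q ^ (T ℕ.* (ℓ C 2)) * (q ^ (ℓ ℕ.* (c₃ ℕ.* ℓ)) * q ^ qExponent k)
          ≈⟨ trans (*-congˡ (sym (^-homo-* q (ℓ ℕ.* (c₃ ℕ.* ℓ)) (qExponent k))))
                   (sym (^-homo-* q (T ℕ.* (ℓ C 2)) (ℓ ℕ.* (c₃ ℕ.* ℓ) ℕ.+ qExponent k))) ⟩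
        q ^ (T ℕ.* (ℓ C 2) ℕ.+ (ℓ ℕ.* (c₃ ℕ.* ℓ) ℕ.+ qExponent k))
          ≡⟨ ≡.cong (q ^_) (≡.trans (q-exponent-identity T c₃ (suc k C 4) ℓ (ℓ C 2))
               (≡.sym (≡.cong₂ (λ a b → a ℕ.* (ℓ C 2) ℕ.+ b ℕ.* (ℓ ℕ.* ℓ)) (binomial-suc (suc k) 2) (binomial-suc (suc k) 3)))) ⟩
        q ^ qExponent (suc k) ∎
        where
        T = suc k C 2
        c₃ = suc k C 3
        split : T ℕ.* (suc ℓ C 2) ≡ T ℕ.* (ℓ C 2) ℕ.+ ℓ ℕ.* T
        split = ≡.trans (≡.cong (T ℕ.*_) (binomial-suc-2 ℓ))
          (≡.trans (ℕₚ.*-distribˡ-+ T (ℓ C 2) ℓ) (≡.cong (T ℕ.* (ℓ C 2) ℕ.+_) (ℕₚ.*-comm T ℓ)))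

      carlitzDet≈closedForm : ∀ k t t⁻¹ → t * t⁻¹ ≈ 1# → carlitzDet t t⁻¹ k ≈ closedForm t t⁻¹ k
      carlitzDet≈closedForm zero t t⁻¹ _ = begin
        1# * ((1# * 1#) * 1#) + 0# ≈⟨ +-identityʳ _ ⟩
        1# * ((1# * 1#) * 1#)      ≈⟨ *-congˡ (*-congˡ (*-identityˡ 1#)) ⟨
        1# * ((1# * 1#) * (1# * 1#)) ∎
      carlitzDet≈closedForm (suc k) t t⁻¹ t*t⁻¹≈1 = begin
        carlitzDet t t⁻¹ (suc k)                             ≈⟨ carlitzDet-suc k t t⁻¹ t*t⁻¹≈1 ⟩
        t⁻¹ ^ suc k * (P * (shiftFactor ℓ k t * carlitzDet t′ t′⁻¹ k))
          ≈⟨ *-congˡ (*-congˡ (*-cong (shiftFactor-closed ℓ k t) (carlitzDet≈closedForm k t′ t′⁻¹ t′*t′⁻¹≈1))) ⟩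
        t⁻¹ ^ suc k * (P * ((sign (T ℕ.* ℓ) * (q ^ (T ℕ.* (suc ℓ C 2)) * t ^ (T ℕ.* ℓ))) *
                            (sign (c₃ ℕ.* ℓ) * ((t′⁻¹ ^ T * t′ ^ (c₃ ℕ.* ℓ)) * (q ^ qExponent k * facProduct t′ k)))))
          ≈⟨ *-congˡ (*-congˡ (*-congˡ (*-congˡ (*-congʳ
               (*-cong (^-distrib-* (q⁻¹ ^ ℓ) t⁻¹ T) (^-distrib-* (q ^ ℓ) t (c₃ ℕ.* ℓ))))))) ⟩
        t⁻¹ ^ suc k * (P * ((sign (T ℕ.* ℓ) * (q ^ (T ℕ.* (suc ℓ C 2)) * t ^ (T ℕ.* ℓ))) *
                            (sign (c₃ ℕ.* ℓ) * ((((q⁻¹ ^ ℓ) ^ T * t⁻¹ ^ T) * ((q ^ ℓ) ^ (c₃ ℕ.* ℓ) * t ^ (c₃ ℕ.* ℓ)))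
                                               * (q ^ qExponent k * facProduct t′ k)))))
          ≈⟨ solve 12 (λ u p s a b s′ c d e g h π →
               (u :* (p :* ((s :* (a :* b)) :* (s′ :* (((c :* d) :* (e :* g)) :* (h :* π)))))) :=
               ((s :* s′) :* (((u :* d) :* (b :* g)) :* (((a :* c) :* (e :* h)) :* (p :* π)))))
               refl _ _ _ _ _ _ _ _ _ _ _ _ ⟩
        (sign (T ℕ.* ℓ) * sign (c₃ ℕ.* ℓ)) *
          (((t⁻¹ ^ suc k * t⁻¹ ^ T) * (t ^ (T ℕ.* ℓ) * t ^ (c₃ ℕ.* ℓ))) *
           (((q ^ (T ℕ.* (suc ℓ C 2)) * (q⁻¹ ^ ℓ) ^ T) * ((q ^ ℓ) ^ (c₃ ℕ.* ℓ) * q ^ qExponent k)) * (P * facProduct t′ k)))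
          ≈⟨ *-cong (powers (- 1#)) (*-cong (*-cong t⁻¹-powers (powers t)) (*-cong (qExponent-suc k) (sym (facProduct-suc k t)))) ⟩
        closedForm t t⁻¹ (suc k) ∎
        where
        T = suc k C 2
        c₃ = suc k C 3
        P = prod1 (suc k) (λ i → carlitz t (i ℕ.* ℓ))
        t′ = q ^ ℓ * t
        t′⁻¹ = q⁻¹ ^ ℓ * t⁻¹
        t′*t′⁻¹≈1 : t′ * t′⁻¹ ≈ 1#
        t′*t′⁻¹≈1 = trans (solve 4 (λ a b c d → ((a :* b) :* (c :* d)) := ((a :* c) :* (b :* d))) refl (q ^ ℓ) t (q⁻¹ ^ ℓ) t⁻¹)
          (trans (*-cong (^-inverse ℓ q*q⁻¹≈1) t*t⁻¹≈1) (*-identityˡ 1#))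
        Tℓ+c₃ℓ : T ℕ.* ℓ ℕ.+ c₃ ℕ.* ℓ ≡ (suc (suc k) C 3) ℕ.* ℓ
        Tℓ+c₃ℓ = ≡.trans (ℕₚ.+-comm (T ℕ.* ℓ) (c₃ ℕ.* ℓ))
          (≡.trans (≡.sym (ℕₚ.*-distribʳ-+ ℓ c₃ T)) (≡.cong (ℕ._* ℓ) (≡.sym (binomial-suc (suc k) 2))))
        powers : ∀ u → u ^ (T ℕ.* ℓ) * u ^ (c₃ ℕ.* ℓ) ≈ u ^ ((suc (suc k) C 3) ℕ.* ℓ)
        powers u = trans (sym (^-homo-* u (T ℕ.* ℓ) (c₃ ℕ.* ℓ))) (^-congʳ u Tℓ+c₃ℓ)
        t⁻¹-powers : t⁻¹ ^ suc k * t⁻¹ ^ T ≈ t⁻¹ ^ (suc (suc k) C 2)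
        t⁻¹-powers = trans (sym (^-homo-* t⁻¹ (suc k) T))
          (^-congʳ t⁻¹ (≡.trans (ℕₚ.+-comm (suc k) T) (≡.sym (binomial-suc-2 (suc k)))))
      facProduct≈prod0-fac : ∀ k t t⁻¹ →
        facProduct t k ≈ prod0 k (λ j → fac q q⁻¹ x (q ^ (ℓ ℕ.* j) * t) (q⁻¹ ^ (ℓ ℕ.* j) * t⁻¹) (k ∸ j) ℓ)
      facProduct≈prod0-fac k t t⁻¹ = prod0-cong k λ j → prod1-cong (k ∸ j) λ i →
        reflexive (≡.sym (f≡carlitz (q ^ (ℓ ℕ.* j) * t) (q⁻¹ ^ (ℓ ℕ.* j) * t⁻¹) (i ℕ.* ℓ)))

    f-pred≈carlitzPred : ∀ t t⁻¹ n → f q q⁻¹ x (q * t) (q⁻¹ * t⁻¹) (ℤ.+ n ℤ.- ℤ.+ 1) ≈ carlitzPred t t⁻¹ n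
    f-pred≈carlitzPred t t⁻¹ zero = begin
      (1# - x * 0#) * ((q * 1#) * (q⁻¹ * t⁻¹))
        ≈⟨ *-cong (trans (+-congˡ (trans (-‿cong (zeroʳ x)) RP.-0#≈0#)) (+-identityʳ 1#))
                  (trans (*-congʳ (*-identityʳ q)) (sym (*-assoc q q⁻¹ t⁻¹))) ⟩
      1# * (q * q⁻¹ * t⁻¹)  ≈⟨ *-identityˡ _ ⟩
      q * q⁻¹ * t⁻¹         ≈⟨ *-congʳ q*q⁻¹≈1 ⟩
      1# * t⁻¹              ≈⟨ *-identityˡ t⁻¹ ⟩
      t⁻¹                   ∎
      where module RP = Algebra.Properties.Ring ring
    f-pred≈carlitzPred t t⁻¹ (suc n) = reflexive (f≡carlitz (q * t) (q⁻¹ * t⁻¹) n)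

lemma3 : {c l : Level} (R : CommutativeRing c l) →
  let open CommutativeRing R
      open Ops R
  in (q qinv x s sinv : Carrier) → q * qinv ≈ 1# → s * sinv ≈ 1# →
     (ℓ k : ℕ) → 0 < k →
     let F : ℤ → Carrier
         F n = f q qinv x s sinv n
         G : ℤ → Carrier
         G n = f q qinv x (q * s) (qinv * sinv) n
         D₁ = det (Data.Nat.suc k) (λ i j →
                (F (+ (ℓ Data.Nat.* toℕ i)) ^ toℕ j)
                * (G (+ (ℓ Data.Nat.* toℕ i) ℤ.- + 1) ^ (k ∸ toℕ j)))
         D₂ = det (Data.Nat.suc k) (λ i j →
                (G (+ (ℓ Data.Nat.* toℕ i) ℤ.- + 1) ^ toℕ j)
                * ((- F (+ (ℓ Data.Nat.* toℕ i))) ^ (k ∸ toℕ j)))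
         RHS = ((- 1#) ^ (((k Data.Nat.+ 1) C 3) Data.Nat.* ℓ))
               * (zpow s sinv (ℤ.- (+ ((k Data.Nat.+ 1) C 2))
                               ℤ.+ + (((k Data.Nat.+ 1) C 3) Data.Nat.* ℓ))
               * ((q ^ (((k Data.Nat.+ 1) C 3) Data.Nat.* (ℓ C 2)
                        Data.Nat.+ ((k Data.Nat.+ 1) C 4) Data.Nat.* (ℓ Data.Nat.* ℓ)))
               * prod0 k (λ j → fac q qinv x ((q ^ (ℓ Data.Nat.* j)) * s)
                                  ((qinv ^ (ℓ Data.Nat.* j)) * sinv) (k ∸ j) ℓ)))
     in (D₁ ≈ D₂) × (D₂ ≈ RHS)
lemma3 R q q⁻¹ x s s⁻¹ q*q⁻¹≈1 s*s⁻¹≈1 ℓ k _ rewrite ℕₚ.+-comm k 1 =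
  sym D₂≈D₁ , trans D₂≈D₁ (trans D₁≈carlitzDet (trans (carlitzDet≈closedForm ℓ k s s⁻¹ s*s⁻¹≈1) closedForm≈RHS))
  where
  open CommutativeRing R
  open Ops R using (f; _^_; zpow; prod0; fac)
  open PowersAndProducts R using (zpow-neg-+)
  open HomogeneousVandermonde R using (homVandermonde; homVandermonde-cong; homVandermonde-swap-neg)
  open CarlitzFibonacci R q q⁻¹ x using (carlitz; carlitzPred; f≡carlitz; module Evaluation)
  open Evaluation q*q⁻¹≈1 using (carlitzDet; carlitzDet≈closedForm; closedForm; facProduct≈prod0-fac; f-pred≈carlitzPred)
  F G : Fin (suc k) → Carrier
  F i = f q q⁻¹ x s s⁻¹ (+ (ℓ ℕ.* toℕ i))
  G i = f q q⁻¹ x (q * s) (q⁻¹ * s⁻¹) (+ (ℓ ℕ.* toℕ i) ℤ.- + 1)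
  D₂≈D₁ : homVandermonde k G (λ i → - F i) ≈ homVandermonde k F G
  D₂≈D₁ = homVandermonde-swap-neg k F G
  D₁≈carlitzDet : homVandermonde k F G ≈ carlitzDet ℓ s s⁻¹ k
  D₁≈carlitzDet = homVandermonde-cong k
    (λ i → reflexive (≡.trans (f≡carlitz s s⁻¹ (ℓ ℕ.* toℕ i)) (≡.cong (carlitz s) (ℕₚ.*-comm ℓ (toℕ i)))))
    (λ i → trans (f-pred≈carlitzPred s s⁻¹ (ℓ ℕ.* toℕ i)) (reflexive (≡.cong (carlitzPred s s⁻¹) (ℕₚ.*-comm ℓ (toℕ i)))))
  closedForm≈RHS : closedForm ℓ s s⁻¹ k ≈
    (- 1#) ^ ((suc k C 3) ℕ.* ℓ) * (zpow s s⁻¹ (ℤ.- (+ (suc k C 2)) ℤ.+ + ((suc k C 3) ℕ.* ℓ))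
      * (q ^ ((suc k C 3) ℕ.* (ℓ C 2) ℕ.+ (suc k C 4) ℕ.* (ℓ ℕ.* ℓ))
         * prod0 k (λ j → fac q q⁻¹ x (q ^ (ℓ ℕ.* j) * s) (q⁻¹ ^ (ℓ ℕ.* j) * s⁻¹) (k ∸ j) ℓ)))
  closedForm≈RHS = *-congˡ (*-cong (sym (zpow-neg-+ s*s⁻¹≈1 (suc k C 2) ((suc k C 3) ℕ.* ℓ)))
                                   (*-congˡ (facProduct≈prod0-fac ℓ k s s⁻¹)))
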